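{- For every positive integer $n$, \[ B_{2n}=(2n)!\sum_{k=0}^{2n}\frac{k!}{(2n+k)!}\sum_{\ell=0}^k(-1)^{\ell}\binom{2n+k}{k-\ell}S(2n+\ell,\ell) \] and \[ \sum_{k=0}^{2n+1} \frac{k!}{(2n+k+1)!}\sum_{\ell=0}^k(-1)^{\ell}\binom{2n+k+1}{k-\ell}S(2n+\ell+1,\ell)=0. \]
   Context: The Bernoulli numbers $B_n$ are defined by $\frac{z}{e^z-1}=\sum_{n=0}^\infty B_n\frac{z^n}{n!}$ for $|z|<2\pi$. $S(n,k)$ denotes the Stirling numbers of the second kind ($S(0,0)=1$, $S(n,0)=0$ for $n\ge1$). -}

module Defs where

open import Data.Nat as ℕ using (ℕ; zero; suc; _+_; _*_; _!; _≤?_)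
open import Data.Nat.Properties using (_!≢0)
open import Data.Nat.Combinatorics using (_C_)
open import Data.Integer as ℤ using (+_)
open import Data.Rational as ℚ using (ℚ; 0ℚ; 1ℚ; _/_)
open import Relation.Nullary using (yes; no)

sumTo : ℕ → (ℕ → ℚ) → ℚ
sumTo zero    f = f 0
sumTo (suc n) f = sumTo n f ℚ.+ f (suc n)

sign : ℕ → ℚ
sign zero    = 1ℚ
sign (suc l) = ℚ.- (sign l)

ℕ→ℚ : ℕ → ℚ
ℕ→ℚ n = (+ n) / 1

_/fact_ : ℕ → ℕ → ℚ
a /fact b = ((+ a) / (b !)) {{b !≢0}}

S : ℕ → ℕ → ℕ
S zero    zero    = 1
S zero    (suc k) = 0
S (suc n) zero    = 0
S (suc n) (suc k) = suc k * S n (suc k) + S n k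

-- Bernoulli numbers defined by z/(e^z-1) = Σ B_n z^n/n!.
-- Comparing coefficients of z^{n+1} in (e^z - 1) · Σ B_j z^j/j! = z gives
-- B_0 = 1 and  Σ_{j=0}^{n} C(n+1,j) B_j = 0  for n ≥ 1, i.e.
-- B_n = -(1/(n+1)) Σ_{j=0}^{n-1} C(n+1,j) B_j.
-- bernUpTo n j = B_j for all j ≤ n.
bernUpTo : ℕ → ℕ → ℚ
bernUpTo zero    j = 1ℚ
bernUpTo (suc n) j with j ≤? n
... | yes _ = bernUpTo n j
... | no  _ = ℚ.- (((+ 1) / (suc (suc n))) ℚ.*
                   sumTo n (λ i → ℕ→ℚ (suc (suc n) C i) ℚ.* bernUpTo n i))

B : ℕ → ℚ
B n = bernUpTo n n

-- Write v = (eᶻ − 1)/z, so that z/(eᶻ − 1) = 1/v has coefficients B_m/m!.  As v has constant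
-- term 1, (1 − v)^k has order k, hence the truncated Neumann series Σ_{k≤M} (1 − v)^k agrees with
-- 1/v up to degree M.  Expanding (1 − v)^k binomially and using
-- v^l = l! Σ_m S(m+l, l) z^m/(m+l)!  (the exponential generating function of S(·, l) is (eᶻ − 1)^l/l!)
-- identifies the coefficient of z^m in (1 − v)^k with the k-th summand of the double sum, which
-- therefore equals B_m/m!.  For the odd case, f = z/(eᶻ − 1) satisfies f(−z) − z = f(z): both sides
-- are inverted by v, because eᶻ · v(−z) = v(z).  So every odd coefficient beyond z¹ vanishes.

module Submission where

open import Defs
open import Data.Nat as ℕ using (ℕ; zero; suc; _∸_; _≤_; _<_; z≤n; s≤s; _!)
import Data.Nat.Properties as ℕₚ
open import Data.Nat.Properties using (_!≢0; _!*_!≢0)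
open import Data.Nat.Combinatorics
  using (_C_; nCk≡n!/k![n-k]!; k![n∸k]!∣n!; k>n⇒nCk≡0; nCk+nC[k+1]≡[n+1]C[k+1]; nCn≡1; nCk≡nC[n∸k]; nC1≡n)
open import Data.Nat.DivMod using (m/n*n≡m)
import Data.Integer as ℤ
import Data.Integer.Properties as ℤₚ
open import Data.Integer.Solver using () renaming (module +-*-Solver to ℤ-Solver)
open import Data.Rational as ℚ using (ℚ; 0ℚ; 1ℚ; _+_; _*_; -_; _-_; toℚᵘ)
import Data.Rational.Properties as ℚₚ
open import Data.Rational.Properties using (toℚᵘ-injective; toℚᵘ-fromℚᵘ; toℚᵘ-homo-+; toℚᵘ-homo-*)
open import Data.Rational.Solver using (module +-*-Solver)
open import Data.Rational.Unnormalised as ℚᵘ using (mkℚᵘ; *≡*)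
import Data.Rational.Unnormalised.Properties as ℚᵘₚ
open import Algebra.Properties.AbelianGroup ℚₚ.+-0-abelianGroup
  using () renaming (∙-cancelˡ to +-cancelˡ; ∙-cancelʳ to +-cancelʳ)
open import Data.Product using (_×_; _,_)
open import Data.Sum using (inj₁; inj₂)
open import Data.Empty using (⊥-elim)
open import Relation.Nullary using (yes; no)
open import Relation.Binary.PropositionalEquality

toℚᵘ-ℕ→ℚ : ∀ a → toℚᵘ (ℕ→ℚ a) ℚᵘ.≃ mkℚᵘ (ℤ.+ a) 0
toℚᵘ-ℕ→ℚ a = toℚᵘ-fromℚᵘ (mkℚᵘ (ℤ.+ a) 0)

ℕ→ℚ-+ : ∀ a b → ℕ→ℚ (a ℕ.+ b) ≡ ℕ→ℚ a + ℕ→ℚ b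
ℕ→ℚ-+ a b = toℚᵘ-injective (begin
  toℚᵘ (ℕ→ℚ (a ℕ.+ b))                  ≈⟨ toℚᵘ-ℕ→ℚ (a ℕ.+ b) ⟩
  mkℚᵘ (ℤ.+ (a ℕ.+ b)) 0                ≈⟨ *≡* numerators ⟩
  mkℚᵘ (ℤ.+ a) 0 ℚᵘ.+ mkℚᵘ (ℤ.+ b) 0    ≈⟨ ℚᵘₚ.+-cong (toℚᵘ-ℕ→ℚ a) (toℚᵘ-ℕ→ℚ b) ⟨
  toℚᵘ (ℕ→ℚ a) ℚᵘ.+ toℚᵘ (ℕ→ℚ b)        ≈⟨ toℚᵘ-homo-+ (ℕ→ℚ a) (ℕ→ℚ b) ⟨
  toℚᵘ (ℕ→ℚ a + ℕ→ℚ b)                  ∎)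
  where
  open ℚᵘₚ.≃-Reasoning
  open ℤ-Solver
  numerators : ℤ.+ (a ℕ.+ b) ℤ.* ℤ.1ℤ ≡ (ℤ.+ a ℤ.* ℤ.1ℤ ℤ.+ ℤ.+ b ℤ.* ℤ.1ℤ) ℤ.* ℤ.1ℤ
  numerators = trans (cong (ℤ._* ℤ.1ℤ) (ℤₚ.pos-+ a b))
    (solve 2 (λ x y → (x :+ y) :* con ℤ.1ℤ := (x :* con ℤ.1ℤ :+ y :* con ℤ.1ℤ) :* con ℤ.1ℤ) refl (ℤ.+ a) (ℤ.+ b))

ℕ→ℚ-* : ∀ a b → ℕ→ℚ (a ℕ.* b) ≡ ℕ→ℚ a * ℕ→ℚ b
ℕ→ℚ-* a b = toℚᵘ-injective (begin
  toℚᵘ (ℕ→ℚ (a ℕ.* b))                  ≈⟨ toℚᵘ-ℕ→ℚ (a ℕ.* b) ⟩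
  mkℚᵘ (ℤ.+ (a ℕ.* b)) 0                ≈⟨ *≡* (cong (ℤ._* ℤ.1ℤ) (ℤₚ.pos-* a b)) ⟩
  mkℚᵘ (ℤ.+ a) 0 ℚᵘ.* mkℚᵘ (ℤ.+ b) 0    ≈⟨ ℚᵘₚ.*-cong (toℚᵘ-ℕ→ℚ a) (toℚᵘ-ℕ→ℚ b) ⟨
  toℚᵘ (ℕ→ℚ a) ℚᵘ.* toℚᵘ (ℕ→ℚ b)        ≈⟨ toℚᵘ-homo-* (ℕ→ℚ a) (ℕ→ℚ b) ⟨
  toℚᵘ (ℕ→ℚ a * ℕ→ℚ b)                  ∎)
  where open ℚᵘₚ.≃-Reasoning

a/n*n≡a : ∀ a n .{{_ : ℕ.NonZero n}} → (ℤ.+ a ℚ./ n) * ℕ→ℚ n ≡ ℕ→ℚ a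
a/n*n≡a a (suc d) = toℚᵘ-injective (begin
  toℚᵘ ((ℤ.+ a ℚ./ suc d) * ℕ→ℚ (suc d))          ≈⟨ toℚᵘ-homo-* (ℤ.+ a ℚ./ suc d) (ℕ→ℚ (suc d)) ⟩
  toℚᵘ (ℤ.+ a ℚ./ suc d) ℚᵘ.* toℚᵘ (ℕ→ℚ (suc d))  ≈⟨ ℚᵘₚ.*-cong (toℚᵘ-fromℚᵘ (mkℚᵘ (ℤ.+ a) d))
                                                                 (toℚᵘ-ℕ→ℚ (suc d)) ⟩
  mkℚᵘ (ℤ.+ a) d ℚᵘ.* mkℚᵘ (ℤ.+ suc d) 0           ≈⟨ *≡* numerators ⟩
  mkℚᵘ (ℤ.+ a) 0                                   ≈⟨ toℚᵘ-ℕ→ℚ a ⟨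
  toℚᵘ (ℕ→ℚ a)                                     ∎)
  where
  open ℚᵘₚ.≃-Reasoning
  numerators : (ℤ.+ a ℤ.* ℤ.+ suc d) ℤ.* ℤ.1ℤ ≡ ℤ.+ a ℤ.* ℤ.+ (suc d ℕ.* 1)
  numerators = trans (ℤₚ.*-identityʳ _) (cong (λ m → ℤ.+ a ℤ.* ℤ.+ m) (sym (ℕₚ.*-identityʳ (suc d))))

ℕ→ℚ-suc≢0 : ∀ n → ℕ→ℚ (suc n) ≢ 0ℚ
ℕ→ℚ-suc≢0 n eq with ℚᵘₚ.≃-trans (ℚᵘₚ.≃-sym (toℚᵘ-ℕ→ℚ (suc n))) (ℚₚ.toℚᵘ-cong eq)
... | *≡* p with trans (sym (ℤₚ.*-identityʳ (ℤ.+ suc n))) p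
... | ()

*-cancelʳ-ℕ→ℚ : ∀ {x y} n .{{_ : ℕ.NonZero n}} → x * ℕ→ℚ n ≡ y * ℕ→ℚ n → x ≡ y
*-cancelʳ-ℕ→ℚ {x} {y} (suc n) eq = begin
  x                   ≡⟨ ℚₚ.*-identityʳ x ⟨
  x * 1ℚ              ≡⟨ cong (x *_) (ℚₚ.*-inverseʳ c) ⟨
  x * (c * ℚ.1/ c)    ≡⟨ ℚₚ.*-assoc x c _ ⟨
  (x * c) * ℚ.1/ c    ≡⟨ cong (_* ℚ.1/ c) eq ⟩
  (y * c) * ℚ.1/ c    ≡⟨ ℚₚ.*-assoc y c _ ⟩
  y * (c * ℚ.1/ c)    ≡⟨ cong (y *_) (ℚₚ.*-inverseʳ c) ⟩
  y * 1ℚ              ≡⟨ ℚₚ.*-identityʳ y ⟩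
  y                   ∎
  where
  open ≡-Reasoning
  c = ℕ→ℚ (suc n)
  instance _ = ℚ.≢-nonZero (ℕ→ℚ-suc≢0 n)

nCk*[k!*[n∸k]!]≡n! : ∀ {n k} → k ≤ n → (n C k) ℕ.* (k ! ℕ.* (n ∸ k) !) ≡ n !
nCk*[k!*[n∸k]!]≡n! {n} {k} k≤n = begin
  (n C k) ℕ.* (k ! ℕ.* (n ∸ k) !)
    ≡⟨ cong (ℕ._* (k ! ℕ.* (n ∸ k) !)) (nCk≡n!/k![n-k]! k≤n) ⟩
  (n ! ℕ./ (k ! ℕ.* (n ∸ k) !)) {{k !* (n ∸ k) !≢0}} ℕ.* (k ! ℕ.* (n ∸ k) !)
    ≡⟨ m/n*n≡m {{k !* (n ∸ k) !≢0}} (k![n∸k]!∣n! k≤n) ⟩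
  n ! ∎
  where open ≡-Reasoning

a/n!*n!≡a : ∀ a n → (a /fact n) * ℕ→ℚ (n !) ≡ ℕ→ℚ a
a/n!*n!≡a a n = a/n*n≡a a (n !) {{n !≢0}}

/fact≡*1/fact : ∀ a n → a /fact n ≡ ℕ→ℚ a * (1 /fact n)
/fact≡*1/fact a n = *-cancelʳ-ℕ→ℚ (n !) {{n !≢0}} (begin
  (a /fact n) * ℕ→ℚ (n !)            ≡⟨ a/n!*n!≡a a n ⟩
  ℕ→ℚ a                              ≡⟨ ℚₚ.*-identityʳ (ℕ→ℚ a) ⟨
  ℕ→ℚ a * 1ℚ                         ≡⟨ cong (ℕ→ℚ a *_) (a/n!*n!≡a 1 n) ⟨
  ℕ→ℚ a * ((1 /fact n) * ℕ→ℚ (n !))  ≡⟨ ℚₚ.*-assoc (ℕ→ℚ a) (1 /fact n) (ℕ→ℚ (n !)) ⟨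
  ℕ→ℚ a * (1 /fact n) * ℕ→ℚ (n !)    ∎)
  where open ≡-Reasoning

nCk/n!≡1/k!*1/[n∸k]! : ∀ {n k} → k ≤ n → ℕ→ℚ (n C k) * (1 /fact n) ≡ (1 /fact k) * (1 /fact (n ∸ k))
nCk/n!≡1/k!*1/[n∸k]! {n} {k} k≤n = *-cancelʳ-ℕ→ℚ (k ! ℕ.* (n ∸ k) !) {{k !* (n ∸ k) !≢0}} (begin
  ℕ→ℚ (n C k) * (1 /fact n) * ℕ→ℚ (k ! ℕ.* (n ∸ k) !)
    ≡⟨ solve 3 (λ c f m → c :* f :* m := f :* (c :* m)) refl (ℕ→ℚ (n C k)) (1 /fact n) (ℕ→ℚ (k ! ℕ.* (n ∸ k) !)) ⟩
  (1 /fact n) * (ℕ→ℚ (n C k) * ℕ→ℚ (k ! ℕ.* (n ∸ k) !))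
    ≡⟨ cong ((1 /fact n) *_) (trans (sym (ℕ→ℚ-* (n C k) _)) (cong ℕ→ℚ (nCk*[k!*[n∸k]!]≡n! k≤n))) ⟩
  (1 /fact n) * ℕ→ℚ (n !)
    ≡⟨ a/n!*n!≡a 1 n ⟩
  1ℚ
    ≡⟨ cong₂ _*_ (a/n!*n!≡a 1 k) (a/n!*n!≡a 1 (n ∸ k)) ⟨
  ((1 /fact k) * ℕ→ℚ (k !)) * ((1 /fact (n ∸ k)) * ℕ→ℚ ((n ∸ k) !))
    ≡⟨ solve 4 (λ a x b y → (a :* x) :* (b :* y) := a :* b :* (x :* y)) refl
         (1 /fact k) (ℕ→ℚ (k !)) (1 /fact (n ∸ k)) (ℕ→ℚ ((n ∸ k) !)) ⟩
  (1 /fact k) * (1 /fact (n ∸ k)) * (ℕ→ℚ (k !) * ℕ→ℚ ((n ∸ k) !))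
    ≡⟨ cong ((1 /fact k) * (1 /fact (n ∸ k)) *_) (ℕ→ℚ-* (k !) ((n ∸ k) !)) ⟨
  (1 /fact k) * (1 /fact (n ∸ k)) * ℕ→ℚ (k ! ℕ.* (n ∸ k) !) ∎)
  where
  open ≡-Reasoning
  open +-*-Solver

nCk≡n!/[k![n∸k]!] : ∀ {n k} → k ≤ n → ℕ→ℚ (n C k) ≡ ℕ→ℚ (n !) * ((1 /fact k) * (1 /fact (n ∸ k)))
nCk≡n!/[k![n∸k]!] {n} {k} k≤n = begin
  ℕ→ℚ (n C k)                               ≡⟨ ℚₚ.*-identityʳ _ ⟨
  ℕ→ℚ (n C k) * 1ℚ                          ≡⟨ cong (ℕ→ℚ (n C k) *_) (a/n!*n!≡a 1 n) ⟨
  ℕ→ℚ (n C k) * ((1 /fact n) * ℕ→ℚ (n !))   ≡⟨ solve 3 (λ c f m → c :* (f :* m) := m :* (c :* f)) refl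
                                                 (ℕ→ℚ (n C k)) (1 /fact n) (ℕ→ℚ (n !)) ⟩
  ℕ→ℚ (n !) * (ℕ→ℚ (n C k) * (1 /fact n))   ≡⟨ cong (ℕ→ℚ (n !) *_) (nCk/n!≡1/k!*1/[n∸k]! k≤n) ⟩
  ℕ→ℚ (n !) * ((1 /fact k) * (1 /fact (n ∸ k))) ∎
  where
  open ≡-Reasoning
  open +-*-Solver

sumTo-cong : ∀ n {f g : ℕ → ℚ} → (∀ i → i ≤ n → f i ≡ g i) → sumTo n f ≡ sumTo n g
sumTo-cong zero    f≡g = f≡g 0 z≤n
sumTo-cong (suc n) f≡g =
  cong₂ _+_ (sumTo-cong n (λ i i≤n → f≡g i (ℕₚ.m≤n⇒m≤1+n i≤n))) (f≡g (suc n) ℕₚ.≤-refl)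

sumTo-zero : ∀ n (f : ℕ → ℚ) → (∀ i → i ≤ n → f i ≡ 0ℚ) → sumTo n f ≡ 0ℚ
sumTo-zero n f f≡0 = trans (sumTo-cong n f≡0) (sumTo-0 n)
  where
  sumTo-0 : ∀ n → sumTo n (λ _ → 0ℚ) ≡ 0ℚ
  sumTo-0 zero    = refl
  sumTo-0 (suc n) = cong (_+ 0ℚ) (sumTo-0 n)

sumTo-+ : ∀ n (f g : ℕ → ℚ) → sumTo n (λ i → f i + g i) ≡ sumTo n f + sumTo n g
sumTo-+ zero    f g = refl
sumTo-+ (suc n) f g = trans (cong (_+ (f (suc n) + g (suc n))) (sumTo-+ n f g))
  (solve 4 (λ a b c d → (a :+ b) :+ (c :+ d) := (a :+ c) :+ (b :+ d)) refl (sumTo n f) (sumTo n g) (f (suc n)) (g (suc n)))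
  where open +-*-Solver

sumTo-*ˡ : ∀ n c (f : ℕ → ℚ) → c * sumTo n f ≡ sumTo n (λ i → c * f i)
sumTo-*ˡ zero    c f = refl
sumTo-*ˡ (suc n) c f =
  trans (ℚₚ.*-distribˡ-+ c (sumTo n f) (f (suc n))) (cong (_+ (c * f (suc n))) (sumTo-*ˡ n c f))

sumTo-*ʳ : ∀ n c (f : ℕ → ℚ) → sumTo n f * c ≡ sumTo n (λ i → f i * c)
sumTo-*ʳ n c f = trans (ℚₚ.*-comm (sumTo n f) c)
  (trans (sumTo-*ˡ n c f) (sumTo-cong n (λ i _ → ℚₚ.*-comm c (f i))))

sumTo-neg : ∀ n (f : ℕ → ℚ) → sumTo n (λ i → - f i) ≡ - sumTo n f
sumTo-neg zero    f = refl
sumTo-neg (suc n) f = trans (cong (_+ (- f (suc n))) (sumTo-neg n f)) (sym (ℚₚ.neg-distrib-+ (sumTo n f) (f (suc n))))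

sumTo-suc : ∀ n (f : ℕ → ℚ) → sumTo (suc n) f ≡ f 0 + sumTo n (λ i → f (suc i))
sumTo-suc zero    f = refl
sumTo-suc (suc n) f = trans (cong (_+ f (suc (suc n))) (sumTo-suc n f)) (ℚₚ.+-assoc (f 0) _ _)

sumTo-comm : ∀ a b (F : ℕ → ℕ → ℚ) →
  sumTo a (λ i → sumTo b (λ j → F i j)) ≡ sumTo b (λ j → sumTo a (λ i → F i j))
sumTo-comm zero    b F = refl
sumTo-comm (suc a) b F = trans (cong (_+ sumTo b (λ j → F (suc a) j)) (sumTo-comm a b F))
  (sym (sumTo-+ b (λ j → sumTo a (λ i → F i j)) (λ j → F (suc a) j)))

sumTo-telescope : ∀ n (f : ℕ → ℚ) → sumTo n (λ k → f k - f (suc k)) ≡ f 0 - f (suc n)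
sumTo-telescope zero    f = refl
sumTo-telescope (suc n) f = trans (cong (_+ (f (suc n) - f (suc (suc n)))) (sumTo-telescope n f))
  (solve 3 (λ a b c → (a :- b) :+ (b :- c) := a :- c) refl (f 0) (f (suc n)) (f (suc (suc n))))
  where open +-*-Solver

sumTo-vanishing-prefix : ∀ m l (f : ℕ → ℚ) → (∀ p → p < l → f p ≡ 0ℚ) →
  sumTo (m ℕ.+ l) f ≡ sumTo m (λ i → f (i ℕ.+ l))
sumTo-vanishing-prefix zero    l f f≡0 = lastTerm l f≡0
  where
  lastTerm : ∀ l → (∀ p → p < l → f p ≡ 0ℚ) → sumTo l f ≡ f l
  lastTerm zero    _   = refl
  lastTerm (suc l) f≡0 = trans (cong (_+ f (suc l)) (sumTo-zero l f (λ i i≤l → f≡0 i (s≤s i≤l)))) (ℚₚ.+-identityˡ _)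
sumTo-vanishing-prefix (suc m) l f f≡0 = cong (_+ f (suc (m ℕ.+ l))) (sumTo-vanishing-prefix m l f f≡0)

sumTo-triangle : ∀ n (F : ℕ → ℕ → ℚ) →
  sumTo n (λ i → sumTo i (λ p → F i p)) ≡ sumTo n (λ p → sumTo (n ∸ p) (λ q → F (p ℕ.+ q) p))
sumTo-triangle zero    F = refl
sumTo-triangle (suc n) F = begin
  sumTo n (λ i → sumTo i (F i)) + sumTo (suc n) (F (suc n))
    ≡⟨ cong (_+ sumTo (suc n) (F (suc n))) (sumTo-triangle n F) ⟩
  sumTo n (λ p → column n p) + (sumTo n (λ p → F (suc n) p) + F (suc n) (suc n))
    ≡⟨ ℚₚ.+-assoc (sumTo n (λ p → column n p)) (sumTo n (λ p → F (suc n) p)) (F (suc n) (suc n)) ⟨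
  (sumTo n (λ p → column n p) + sumTo n (λ p → F (suc n) p)) + F (suc n) (suc n)
    ≡⟨ cong₂ _+_ (trans (sym (sumTo-+ n _ _)) (sumTo-cong n extendColumn))
                 (cong (λ m → F m (suc n)) (sym (ℕₚ.+-identityʳ (suc n)))) ⟩
  sumTo n (λ p → column (suc n) p) + F (suc n ℕ.+ 0) (suc n)
    ≡⟨ cong (λ m → sumTo n (λ p → column (suc n) p) + sumTo m (λ q → F (suc n ℕ.+ q) (suc n))) (ℕₚ.n∸n≡0 n) ⟨
  sumTo (suc n) (λ p → column (suc n) p) ∎
  where
  open ≡-Reasoning
  column : ℕ → ℕ → ℚ
  column n p = sumTo (n ∸ p) (λ q → F (p ℕ.+ q) p)
  extendColumn : ∀ p → p ≤ n → column n p + F (suc n) p ≡ column (suc n) p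
  extendColumn p p≤n rewrite ℕₚ.+-∸-assoc 1 p≤n = cong (λ m → column n p + F m p)
    (trans (cong suc (sym (ℕₚ.m+[n∸m]≡n p≤n))) (sym (ℕₚ.+-suc p (n ∸ p))))

Series : Set
Series = ℕ → ℚ

infixl 7 _⋆_

_⋆_ : Series → Series → Series
(f ⋆ g) j = sumTo j (λ i → f (j ∸ i) * g i)

δ : Series
δ zero    = 1ℚ
δ (suc _) = 0ℚ

sumTo-*δ : ∀ n (f : Series) → sumTo n (λ i → f i * δ i) ≡ f 0
sumTo-*δ zero    f = ℚₚ.*-identityʳ (f 0)
sumTo-*δ (suc n) f = trans (cong₂ _+_ (sumTo-*δ n f) (ℚₚ.*-zeroʳ (f (suc n)))) (ℚₚ.+-identityʳ (f 0))

⋆-identityʳ : ∀ f j → (f ⋆ δ) j ≡ f j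
⋆-identityʳ f j = sumTo-*δ j (λ i → f (j ∸ i))

⋆-suc : ∀ f g j → (f ⋆ g) (suc j) ≡ sumTo j (λ i → f (suc j ∸ i) * g i) + f 0 * g (suc j)
⋆-suc f g j = cong (λ m → sumTo j (λ i → f (suc j ∸ i) * g i) + f m * g (suc j)) (ℕₚ.n∸n≡0 j)

⋆-congˡ : ∀ {f f′} g j → (∀ i → f i ≡ f′ i) → (f ⋆ g) j ≡ (f′ ⋆ g) j
⋆-congˡ g j f≡f′ = sumTo-cong j (λ i _ → cong (_* g i) (f≡f′ _))

⋆-congʳ : ∀ f {g g′} j → (∀ i → i ≤ j → g i ≡ g′ i) → (f ⋆ g) j ≡ (f ⋆ g′) j
⋆-congʳ f j g≡g′ = sumTo-cong j (λ i i≤j → cong (f (j ∸ i) *_) (g≡g′ i i≤j))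

⋆-*ʳ : ∀ f c g j → (f ⋆ (λ i → c * g i)) j ≡ c * (f ⋆ g) j
⋆-*ʳ f c g j = trans
  (sumTo-cong j (λ i _ → solve 3 (λ a b d → a :* (b :* d) := b :* (a :* d)) refl (f (j ∸ i)) c (g i)))
  (sym (sumTo-*ˡ j c _))
  where open +-*-Solver

⋆-subʳ : ∀ f g h j → (f ⋆ (λ i → g i - h i)) j ≡ (f ⋆ g) j - (f ⋆ h) j
⋆-subʳ f g h j = trans
  (sumTo-cong j (λ i _ → solve 3 (λ a x y → a :* (x :- y) := a :* x :+ :- (a :* y)) refl (f (j ∸ i)) (g i) (h i)))
  (trans (sumTo-+ j _ _) (cong (λ s → (f ⋆ g) j + s) (sumTo-neg j _)))
  where open +-*-Solver

⋆-sumToʳ : ∀ f n (g : ℕ → Series) j → (f ⋆ (λ i → sumTo n (λ k → g k i))) j ≡ sumTo n (λ k → (f ⋆ g k) j)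
⋆-sumToʳ f n g j = trans (sumTo-cong j (λ i _ → sumTo-*ˡ n (f (j ∸ i)) (λ k → g k i)))
  (sumTo-comm j n (λ i k → f (j ∸ i) * g k i))

⋆-assoc : ∀ f g h j → ((f ⋆ g) ⋆ h) j ≡ (f ⋆ (g ⋆ h)) j
⋆-assoc f g h j = begin
  sumTo j (λ i → (f ⋆ g) (j ∸ i) * h i)
    ≡⟨ sumTo-cong j (λ i _ → trans (sumTo-*ʳ (j ∸ i) (h i) _) (sumTo-cong (j ∸ i) (λ q _ → reindex i q))) ⟩
  sumTo j (λ p → sumTo (j ∸ p) (λ q → f (j ∸ (p ℕ.+ q)) * (g ((p ℕ.+ q) ∸ p) * h p)))
    ≡⟨ sumTo-triangle j (λ i p → f (j ∸ i) * (g (i ∸ p) * h p)) ⟨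
  sumTo j (λ i → sumTo i (λ p → f (j ∸ i) * (g (i ∸ p) * h p)))
    ≡⟨ sumTo-cong j (λ i _ → sym (sumTo-*ˡ i (f (j ∸ i)) _)) ⟩
  (f ⋆ (g ⋆ h)) j ∎
  where
  open ≡-Reasoning
  reindex : ∀ i q → f (j ∸ i ∸ q) * g q * h i ≡ f (j ∸ (i ℕ.+ q)) * (g ((i ℕ.+ q) ∸ i) * h i)
  reindex i q = trans (ℚₚ.*-assoc (f (j ∸ i ∸ q)) (g q) (h i))
    (cong₂ (λ a b → f a * (g b * h i)) (ℕₚ.∸-+-assoc j i q) (sym (ℕₚ.m+n∸m≡n i q)))

⋆-cancelˡ : ∀ {f} → f 0 ≡ 1ℚ → ∀ M (x y : Series) →
  (∀ j → j ≤ M → (f ⋆ x) j ≡ (f ⋆ y) j) → ∀ j → j ≤ M → x j ≡ y j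
⋆-cancelˡ {f} f₀≡1 M x y fx≡fy j j≤M = agreeUpTo j j≤M j ℕₚ.≤-refl
  where
  leading : ∀ {a b} → f 0 * a ≡ f 0 * b → a ≡ b
  leading {a} {b} eq = begin
    a          ≡⟨ ℚₚ.*-identityˡ a ⟨
    1ℚ * a     ≡⟨ cong (_* a) f₀≡1 ⟨
    f 0 * a    ≡⟨ eq ⟩
    f 0 * b    ≡⟨ cong (_* b) f₀≡1 ⟩
    1ℚ * b     ≡⟨ ℚₚ.*-identityˡ b ⟩
    b          ∎
    where open ≡-Reasoning
  agreeUpTo : ∀ j → j ≤ M → ∀ i → i ≤ j → x i ≡ y i
  agreeUpTo zero    j≤M .zero z≤n = leading (fx≡fy 0 j≤M)
  agreeUpTo (suc j) j<M i i≤1+j with ℕₚ.m≤n⇒m<n∨m≡n i≤1+j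
  ... | inj₁ (s≤s i≤j) = agreeUpTo j (ℕₚ.<⇒≤ j<M) i i≤j
  ... | inj₂ refl      = leading (+-cancelˡ (prefix y) _ _ (begin
    prefix y + f 0 * x (suc j)  ≡⟨ cong (λ s → s + f 0 * x (suc j)) samePrefix ⟨
    prefix x + f 0 * x (suc j)  ≡⟨ ⋆-suc f x j ⟨
    (f ⋆ x) (suc j)             ≡⟨ fx≡fy (suc j) j<M ⟩
    (f ⋆ y) (suc j)             ≡⟨ ⋆-suc f y j ⟩
    prefix y + f 0 * y (suc j)  ∎))
    where
    open ≡-Reasoning
    prefix : Series → ℚ
    prefix g = sumTo j (λ i → f (suc j ∸ i) * g i)
    samePrefix : prefix x ≡ prefix y
    samePrefix = sumTo-cong j (λ i i≤j → cong (f (suc j ∸ i) *_) (agreeUpTo j (ℕₚ.<⇒≤ j<M) i i≤j))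

infixr 8 _^_ [δ-_]^_

_^_ : Series → ℕ → Series
f ^ zero  = δ
f ^ suc l = f ⋆ f ^ l

[δ-_]^_ : Series → ℕ → Series
([δ- f ]^ k) j = sumTo k (λ l → sign l * (ℕ→ℚ (k C l) * (f ^ l) j))

neumann : Series → ℕ → Series
neumann f M j = sumTo M (λ k → ([δ- f ]^ k) j)

⋆-[δ-]^ : ∀ f k j → (f ⋆ [δ- f ]^ k) j ≡ sumTo k (λ l → sign l * (ℕ→ℚ (k C l) * (f ^ suc l) j))
⋆-[δ-]^ f k j = trans (⋆-sumToʳ f k (λ l i → sign l * (ℕ→ℚ (k C l) * (f ^ l) i)) j)
  (sumTo-cong k (λ l _ → begin
    (f ⋆ (λ i → sign l * (ℕ→ℚ (k C l) * (f ^ l) i))) j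
      ≡⟨ ⋆-congʳ f j (λ i _ → ℚₚ.*-assoc (sign l) (ℕ→ℚ (k C l)) ((f ^ l) i)) ⟨
    (f ⋆ (λ i → sign l * ℕ→ℚ (k C l) * (f ^ l) i)) j
      ≡⟨ ⋆-*ʳ f (sign l * ℕ→ℚ (k C l)) (f ^ l) j ⟩
    sign l * ℕ→ℚ (k C l) * (f ^ suc l) j
      ≡⟨ ℚₚ.*-assoc (sign l) (ℕ→ℚ (k C l)) ((f ^ suc l) j) ⟩
    sign l * (ℕ→ℚ (k C l) * (f ^ suc l) j) ∎))
  where open ≡-Reasoning

[δ-]^-suc : ∀ f k j → ([δ- f ]^ suc k) j ≡ ([δ- f ]^ k) j - (f ⋆ [δ- f ]^ k) j
[δ-]^-suc f k j = begin
  ([δ- f ]^ suc k) j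
    ≡⟨ sumTo-suc k _ ⟩
  t₀ + sumTo k (λ l → sign (suc l) * (ℕ→ℚ (suc k C suc l) * (f ^ suc l) j))
    ≡⟨ cong (t₀ +_) (trans (sumTo-cong k (λ l _ → pascal l))
                           (trans (sumTo-+ k _ _) (cong (_+ shifted) (sumTo-neg k _)))) ⟩
  t₀ + (- sumTo k (λ l → sign l * (ℕ→ℚ (k C l) * (f ^ suc l) j)) + shifted)
    ≡⟨ cong (λ s → t₀ + (- s + shifted)) (⋆-[δ-]^ f k j) ⟨
  t₀ + (- (f ⋆ [δ- f ]^ k) j + shifted)
    ≡⟨ solve 3 (λ a t q → a :+ (:- t :+ q) := (a :+ q) :- t) refl t₀ ((f ⋆ [δ- f ]^ k) j) shifted ⟩
  (t₀ + shifted) - (f ⋆ [δ- f ]^ k) j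
    ≡⟨ cong (_- (f ⋆ [δ- f ]^ k) j) split ⟨
  ([δ- f ]^ k) j - (f ⋆ [δ- f ]^ k) j ∎
  where
  open ≡-Reasoning
  open +-*-Solver
  t₀ = sign 0 * (ℕ→ℚ (k C 0) * (f ^ 0) j)
  shifted = sumTo k (λ l → sign (suc l) * (ℕ→ℚ (k C suc l) * (f ^ suc l) j))
  pascal : ∀ l → sign (suc l) * (ℕ→ℚ (suc k C suc l) * (f ^ suc l) j)
               ≡ - (sign l * (ℕ→ℚ (k C l) * (f ^ suc l) j)) + sign (suc l) * (ℕ→ℚ (k C suc l) * (f ^ suc l) j)
  pascal l = trans
    (cong (λ c → sign (suc l) * (c * (f ^ suc l) j))
      (trans (cong ℕ→ℚ (sym (nCk+nC[k+1]≡[n+1]C[k+1] k l))) (ℕ→ℚ-+ (k C l) (k C suc l))))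
    (solve 4 (λ s a b p → (:- s) :* ((a :+ b) :* p) := (:- (s :* (a :* p))) :+ (:- s) :* (b :* p))
      refl (sign l) (ℕ→ℚ (k C l)) (ℕ→ℚ (k C suc l)) ((f ^ suc l) j))
  lastVanishes : sign (suc k) * (ℕ→ℚ (k C suc k) * (f ^ suc k) j) ≡ 0ℚ
  lastVanishes = begin
    sign (suc k) * (ℕ→ℚ (k C suc k) * (f ^ suc k) j)  ≡⟨ cong (λ c → sign (suc k) * (ℕ→ℚ c * (f ^ suc k) j))
                                                             (k>n⇒nCk≡0 (ℕₚ.n<1+n k)) ⟩
    sign (suc k) * (0ℚ * (f ^ suc k) j)                 ≡⟨ cong (sign (suc k) *_) (ℚₚ.*-zeroˡ ((f ^ suc k) j)) ⟩
    sign (suc k) * 0ℚ                                   ≡⟨ ℚₚ.*-zeroʳ (sign (suc k)) ⟩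
    0ℚ                                                  ∎
  split : ([δ- f ]^ k) j ≡ t₀ + shifted
  split = begin
    ([δ- f ]^ k) j                                            ≡⟨ ℚₚ.+-identityʳ _ ⟨
    ([δ- f ]^ k) j + 0ℚ                                       ≡⟨ cong (λ s → ([δ- f ]^ k) j + s) lastVanishes ⟨
    sumTo (suc k) (λ l → sign l * (ℕ→ℚ (k C l) * (f ^ l) j))  ≡⟨ sumTo-suc k _ ⟩
    t₀ + shifted                                              ∎

[δ-]^-vanishes : ∀ {f} → f 0 ≡ 1ℚ → ∀ k j → j < k → ([δ- f ]^ k) j ≡ 0ℚ
[δ-]^-vanishes {f} f₀≡1 (suc k) zero _ = begin
  ([δ- f ]^ suc k) 0                       ≡⟨ [δ-]^-suc f k 0 ⟩
  ([δ- f ]^ k) 0 - f 0 * ([δ- f ]^ k) 0    ≡⟨ cong (λ c → ([δ- f ]^ k) 0 - c * ([δ- f ]^ k) 0) f₀≡1 ⟩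
  ([δ- f ]^ k) 0 - 1ℚ * ([δ- f ]^ k) 0     ≡⟨ solve 1 (λ x → x :- con 1ℚ :* x := con 0ℚ) refl (([δ- f ]^ k) 0) ⟩
  0ℚ                                       ∎
  where
  open ≡-Reasoning
  open +-*-Solver
[δ-]^-vanishes {f} f₀≡1 (suc k) (suc j) (s≤s j<k) = begin
  ([δ- f ]^ suc k) (suc j)
    ≡⟨ [δ-]^-suc f k (suc j) ⟩
  g (suc j) - (f ⋆ g) (suc j)
    ≡⟨ cong (λ s → g (suc j) - s) (⋆-suc f g j) ⟩
  g (suc j) - (sumTo j (λ i → f (suc j ∸ i) * g i) + f 0 * g (suc j))
    ≡⟨ cong₂ (λ s c → g (suc j) - (s + c * g (suc j))) (sumTo-zero j _ lowerTermsVanish) f₀≡1 ⟩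
  g (suc j) - (0ℚ + 1ℚ * g (suc j))
    ≡⟨ solve 1 (λ x → x :- (con 0ℚ :+ con 1ℚ :* x) := con 0ℚ) refl (g (suc j)) ⟩
  0ℚ ∎
  where
  open ≡-Reasoning
  open +-*-Solver
  g = [δ- f ]^ k
  lowerTermsVanish : ∀ i → i ≤ j → f (suc j ∸ i) * g i ≡ 0ℚ
  lowerTermsVanish i i≤j = trans (cong (f (suc j ∸ i) *_) ([δ-]^-vanishes f₀≡1 k i (ℕₚ.≤-<-trans i≤j j<k)))
    (ℚₚ.*-zeroʳ (f (suc j ∸ i)))

⋆-neumann : ∀ {f} → f 0 ≡ 1ℚ → ∀ M j → j ≤ M → (f ⋆ neumann f M) j ≡ δ j
⋆-neumann {f} f₀≡1 M j j≤M = begin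
  (f ⋆ neumann f M) j
    ≡⟨ ⋆-sumToʳ f M (λ k → [δ- f ]^ k) j ⟩
  sumTo M (λ k → (f ⋆ [δ- f ]^ k) j)
    ≡⟨ sumTo-cong M (λ k _ → differenceOfPowers k) ⟩
  sumTo M (λ k → ([δ- f ]^ k) j - ([δ- f ]^ suc k) j)
    ≡⟨ sumTo-telescope M (λ k → ([δ- f ]^ k) j) ⟩
  ([δ- f ]^ 0) j - ([δ- f ]^ suc M) j
    ≡⟨ cong (λ s → ([δ- f ]^ 0) j - s) ([δ-]^-vanishes f₀≡1 (suc M) j (s≤s j≤M)) ⟩
  ([δ- f ]^ 0) j - 0ℚ
    ≡⟨ solve 1 (λ x → con 1ℚ :* (con 1ℚ :* x) :- con 0ℚ := x) refl (δ j) ⟩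
  δ j ∎
  where
  open ≡-Reasoning
  open +-*-Solver
  differenceOfPowers : ∀ k → (f ⋆ [δ- f ]^ k) j ≡ ([δ- f ]^ k) j - ([δ- f ]^ suc k) j
  differenceOfPowers k = trans
    (solve 2 (λ a b → b := a :- (a :- b)) refl (([δ- f ]^ k) j) ((f ⋆ [δ- f ]^ k) j))
    (cong (λ s → ([δ- f ]^ k) j - s) (sym ([δ-]^-suc f k j)))

neumann≡inverse : ∀ {f} g → f 0 ≡ 1ℚ → (∀ j → (f ⋆ g) j ≡ δ j) → ∀ M j → j ≤ M → neumann f M j ≡ g j
neumann≡inverse {f} g f₀≡1 fg≡δ M =
  ⋆-cancelˡ {f} f₀≡1 M (neumann f M) g (λ j j≤M → trans (⋆-neumann {f} f₀≡1 M j j≤M) (sym (fg≡δ j)))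

S-vanishes : ∀ {p l} → p < l → S p l ≡ 0
S-vanishes {zero}  {suc l} _ = refl
S-vanishes {suc p} {suc l} (s≤s p<l)
  rewrite S-vanishes {p} {suc l} (ℕₚ.m<n⇒m<1+n p<l) | S-vanishes p<l = trans (ℕₚ.+-identityʳ (suc l ℕ.* 0)) (ℕₚ.*-zeroʳ (suc l))

sumTo-C*S-suc : ∀ N l → sumTo (suc N) (λ p → ℕ→ℚ (suc N C p) * ℕ→ℚ (S p l))
  ≡ sumTo N (λ p → ℕ→ℚ (N C p) * ℕ→ℚ (S (suc p) l)) + sumTo N (λ p → ℕ→ℚ (N C p) * ℕ→ℚ (S p l))
sumTo-C*S-suc N l = begin
  sumTo (suc N) (λ p → ℕ→ℚ (suc N C p) * s p)
    ≡⟨ sumTo-suc N _ ⟩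
  1ℚ * s 0 + sumTo N (λ p → ℕ→ℚ (suc N C suc p) * s (suc p))
    ≡⟨ cong₂ _+_ (ℚₚ.*-identityˡ (s 0)) (trans (sumTo-cong N (λ p _ → pascal p)) (sumTo-+ N _ _)) ⟩
  s 0 + (X + Y)
    ≡⟨ solve 3 (λ a x y → a :+ (x :+ y) := x :+ (a :+ y)) refl (s 0) X Y ⟩
  X + (s 0 + Y)
    ≡⟨ cong (X +_) split ⟨
  X + sumTo N (λ p → ℕ→ℚ (N C p) * s p) ∎
  where
  open ≡-Reasoning
  open +-*-Solver
  s : ℕ → ℚ
  s p = ℕ→ℚ (S p l)
  X = sumTo N (λ p → ℕ→ℚ (N C p) * s (suc p))
  Y = sumTo N (λ p → ℕ→ℚ (N C suc p) * s (suc p))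
  pascal : ∀ p → ℕ→ℚ (suc N C suc p) * s (suc p) ≡ ℕ→ℚ (N C p) * s (suc p) + ℕ→ℚ (N C suc p) * s (suc p)
  pascal p = trans (cong (λ c → ℕ→ℚ c * s (suc p)) (sym (nCk+nC[k+1]≡[n+1]C[k+1] N p)))
    (trans (cong (_* s (suc p)) (ℕ→ℚ-+ (N C p) (N C suc p))) (ℚₚ.*-distribʳ-+ (s (suc p)) (ℕ→ℚ (N C p)) (ℕ→ℚ (N C suc p))))
  split : sumTo N (λ p → ℕ→ℚ (N C p) * s p) ≡ s 0 + Y
  split = begin
    sumTo N (λ p → ℕ→ℚ (N C p) * s p)
      ≡⟨ ℚₚ.+-identityʳ _ ⟨
    sumTo N (λ p → ℕ→ℚ (N C p) * s p) + 0ℚ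
      ≡⟨ cong (λ t → sumTo N (λ p → ℕ→ℚ (N C p) * s p) + t)
           (trans (cong (λ c → ℕ→ℚ c * s (suc N)) (k>n⇒nCk≡0 (ℕₚ.n<1+n N))) (ℚₚ.*-zeroˡ (s (suc N)))) ⟨
    sumTo (suc N) (λ p → ℕ→ℚ (N C p) * s p)
      ≡⟨ sumTo-suc N _ ⟩
    1ℚ * s 0 + Y
      ≡⟨ cong (_+ Y) (ℚₚ.*-identityˡ (s 0)) ⟩
    s 0 + Y ∎

sumTo-C*S : ∀ N l → sumTo N (λ p → ℕ→ℚ (N C p) * ℕ→ℚ (S p l)) ≡ ℕ→ℚ (S (suc N) (suc l))
sumTo-C*S zero l =
  trans (ℚₚ.*-identityˡ (ℕ→ℚ (S 0 l))) (cong (λ t → ℕ→ℚ (t ℕ.+ S 0 l)) (sym (ℕₚ.*-zeroʳ l)))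
sumTo-C*S (suc N) zero = begin
  sumTo (suc N) (λ p → ℕ→ℚ (suc N C p) * ℕ→ℚ (S p 0))
    ≡⟨ sumTo-C*S-suc N 0 ⟩
  sumTo N (λ p → ℕ→ℚ (N C p) * 0ℚ) + sumTo N (λ p → ℕ→ℚ (N C p) * ℕ→ℚ (S p 0))
    ≡⟨ cong₂ _+_ (sumTo-zero N _ (λ p _ → ℚₚ.*-zeroʳ (ℕ→ℚ (N C p)))) (sumTo-C*S N 0) ⟩
  0ℚ + ℕ→ℚ (S (suc N) 1)
    ≡⟨ ℚₚ.+-identityˡ _ ⟩
  ℕ→ℚ (S (suc N) 1)
    ≡⟨ cong ℕ→ℚ (trans (ℕₚ.+-identityʳ (1 ℕ.* S (suc N) 1)) (ℕₚ.*-identityˡ (S (suc N) 1))) ⟨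
  ℕ→ℚ (S (suc (suc N)) 1) ∎
  where open ≡-Reasoning
sumTo-C*S (suc N) (suc l) = begin
  sumTo (suc N) (λ p → ℕ→ℚ (suc N C p) * s p (suc l))
    ≡⟨ sumTo-C*S-suc N (suc l) ⟩
  sumTo N (λ p → ℕ→ℚ (N C p) * s (suc p) (suc l)) + A (suc l)
    ≡⟨ cong (_+ A (suc l)) (sumTo-cong N (λ p _ → stirlingStep p)) ⟩
  sumTo N (λ p → k * (ℕ→ℚ (N C p) * s p (suc l)) + ℕ→ℚ (N C p) * s p l) + A (suc l)
    ≡⟨ cong (_+ A (suc l)) (trans (sumTo-+ N _ _) (cong (_+ A l) (sym (sumTo-*ˡ N k _)))) ⟩
  (k * A (suc l) + A l) + A (suc l)
    ≡⟨ cong₂ _+_ (cong₂ _+_ (cong (k *_) (sumTo-C*S N (suc l))) (sumTo-C*S N l)) (sumTo-C*S N (suc l)) ⟩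
  (k * a + b) + a
    ≡⟨ solve 3 (λ k a b → (k :* a :+ b) :+ a := (con 1ℚ :+ k) :* a :+ b) refl k a b ⟩
  (1ℚ + k) * a + b
    ≡⟨ trans (ℕ→ℚ-+ (suc (suc l) ℕ.* S (suc N) (suc (suc l))) (S (suc N) (suc l)))
         (cong (_+ b) (trans (ℕ→ℚ-* (suc (suc l)) (S (suc N) (suc (suc l)))) (cong (_* a) (ℕ→ℚ-+ 1 (suc l))))) ⟨
  s (suc (suc N)) (suc (suc l)) ∎
  where
  open ≡-Reasoning
  open +-*-Solver
  s : ℕ → ℕ → ℚ
  s p l = ℕ→ℚ (S p l)
  A : ℕ → ℚ
  A l = sumTo N (λ p → ℕ→ℚ (N C p) * s p l)
  k = ℕ→ℚ (suc l)
  a = s (suc N) (suc (suc l))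
  b = s (suc N) (suc l)
  stirlingStep : ∀ p → ℕ→ℚ (N C p) * s (suc p) (suc l) ≡ k * (ℕ→ℚ (N C p) * s p (suc l)) + ℕ→ℚ (N C p) * s p l
  stirlingStep p = trans
    (cong (ℕ→ℚ (N C p) *_) (trans (ℕ→ℚ-+ (suc l ℕ.* S p (suc l)) (S p l)) (cong (_+ s p l) (ℕ→ℚ-* (suc l) (S p (suc l))))))
    (solve 4 (λ x y z w → x :* (y :* z :+ w) := y :* (x :* z) :+ x :* w) refl (ℕ→ℚ (N C p)) k (s p (suc l)) (s p l))

sumTo-C*S-below : ∀ N l → sumTo N (λ p → ℕ→ℚ (suc N C p) * ℕ→ℚ (S p l)) ≡ ℕ→ℚ (suc l ℕ.* S (suc N) (suc l))
sumTo-C*S-below N l = +-cancelʳ (ℕ→ℚ (S (suc N) l)) _ _ (begin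
  sumTo N (λ p → ℕ→ℚ (suc N C p) * ℕ→ℚ (S p l)) + ℕ→ℚ (S (suc N) l)
    ≡⟨ cong (λ t → sumTo N (λ p → ℕ→ℚ (suc N C p) * ℕ→ℚ (S p l)) + t) lastTerm ⟨
  sumTo (suc N) (λ p → ℕ→ℚ (suc N C p) * ℕ→ℚ (S p l))
    ≡⟨ sumTo-C*S (suc N) l ⟩
  ℕ→ℚ (S (suc (suc N)) (suc l))
    ≡⟨ ℕ→ℚ-+ (suc l ℕ.* S (suc N) (suc l)) (S (suc N) l) ⟩
  ℕ→ℚ (suc l ℕ.* S (suc N) (suc l)) + ℕ→ℚ (S (suc N) l) ∎)
  where
  open ≡-Reasoning
  lastTerm : ℕ→ℚ (suc N C suc N) * ℕ→ℚ (S (suc N) l) ≡ ℕ→ℚ (S (suc N) l)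
  lastTerm = trans (cong (λ c → ℕ→ℚ c * ℕ→ℚ (S (suc N) l)) (nCn≡1 (suc N))) (ℚₚ.*-identityˡ _)

eᶻ : Series
eᶻ j = 1 /fact j

[eᶻ-1]/z : Series
[eᶻ-1]/z j = 1 /fact (suc j)

[eᶻ-1]/z^ : ∀ l m → ([eᶻ-1]/z ^ l) m ≡ ℕ→ℚ (l !) * (ℕ→ℚ (S (m ℕ.+ l) l) * (1 /fact (m ℕ.+ l)))
[eᶻ-1]/z^ zero zero    = refl
[eᶻ-1]/z^ zero (suc m) = sym (trans (ℚₚ.*-identityˡ _) (ℚₚ.*-zeroˡ (1 /fact (suc m ℕ.+ 0))))
[eᶻ-1]/z^ (suc l) m rewrite ℕₚ.+-suc m l = begin
  ([eᶻ-1]/z ⋆ [eᶻ-1]/z ^ l) m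
    ≡⟨ sumTo-cong m (λ i i≤m → trans (cong ([eᶻ-1]/z (m ∸ i) *_) ([eᶻ-1]/z^ l i)) (term i i≤m)) ⟩
  sumTo m (λ i → c * g (i ℕ.+ l))
    ≡⟨ sumTo-*ˡ m c _ ⟨
  c * sumTo m (λ i → g (i ℕ.+ l))
    ≡⟨ cong (c *_) (sumTo-vanishing-prefix m l g lowerTermsVanish) ⟨
  c * sumTo n g
    ≡⟨ cong (c *_) (sumTo-C*S-below n l) ⟩
  c * ℕ→ℚ (suc l ℕ.* S (suc n) (suc l))
    ≡⟨ cong (c *_) (ℕ→ℚ-* (suc l) (S (suc n) (suc l))) ⟩
  c * (ℕ→ℚ (suc l) * ℕ→ℚ (S (suc n) (suc l)))
    ≡⟨ solve 4 (λ L f k s → (L :* f) :* (k :* s) := (k :* L) :* (s :* f)) refl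
         (ℕ→ℚ (l !)) (1 /fact (suc n)) (ℕ→ℚ (suc l)) (ℕ→ℚ (S (suc n) (suc l))) ⟩
  ℕ→ℚ (suc l) * ℕ→ℚ (l !) * (ℕ→ℚ (S (suc n) (suc l)) * (1 /fact (suc n)))
    ≡⟨ cong (_* (ℕ→ℚ (S (suc n) (suc l)) * (1 /fact (suc n)))) (ℕ→ℚ-* (suc l) (l !)) ⟨
  ℕ→ℚ (suc l !) * (ℕ→ℚ (S (suc n) (suc l)) * (1 /fact (suc n))) ∎
  where
  open ≡-Reasoning
  open +-*-Solver
  n = m ℕ.+ l
  c = ℕ→ℚ (l !) * (1 /fact (suc n))
  g : ℕ → ℚ
  g p = ℕ→ℚ (suc n C p) * ℕ→ℚ (S p l)
  lowerTermsVanish : ∀ p → p < l → g p ≡ 0ℚ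
  lowerTermsVanish p p<l =
    trans (cong (λ s → ℕ→ℚ (suc n C p) * ℕ→ℚ s) (S-vanishes p<l)) (ℚₚ.*-zeroʳ (ℕ→ℚ (suc n C p)))
  weights : ∀ i → i ≤ m → (1 /fact (suc (m ∸ i))) * (1 /fact (i ℕ.+ l)) ≡ ℕ→ℚ (suc n C (i ℕ.+ l)) * (1 /fact (suc n))
  weights i i≤m = begin
    (1 /fact (suc (m ∸ i))) * (1 /fact (i ℕ.+ l))
      ≡⟨ ℚₚ.*-comm (1 /fact (suc (m ∸ i))) (1 /fact (i ℕ.+ l)) ⟩
    (1 /fact (i ℕ.+ l)) * (1 /fact (suc (m ∸ i)))
      ≡⟨ cong (λ k → (1 /fact (i ℕ.+ l)) * (1 /fact k)) complement ⟨
    (1 /fact (i ℕ.+ l)) * (1 /fact (suc n ∸ (i ℕ.+ l)))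
      ≡⟨ nCk/n!≡1/k!*1/[n∸k]! (ℕₚ.m≤n⇒m≤1+n (ℕₚ.+-monoˡ-≤ l i≤m)) ⟨
    ℕ→ℚ (suc n C (i ℕ.+ l)) * (1 /fact (suc n)) ∎
    where
    complement : suc n ∸ (i ℕ.+ l) ≡ suc (m ∸ i)
    complement = trans (cong₂ _∸_ (cong suc (ℕₚ.+-comm m l)) (ℕₚ.+-comm i l))
      (trans (cong (_∸ (l ℕ.+ i)) (sym (ℕₚ.+-suc l m))) (trans (ℕₚ.[m+n]∸[m+o]≡n∸o l (suc m) i) (ℕₚ.+-∸-assoc 1 i≤m)))
  term : ∀ i → i ≤ m → [eᶻ-1]/z (m ∸ i) * (ℕ→ℚ (l !) * (ℕ→ℚ (S (i ℕ.+ l) l) * (1 /fact (i ℕ.+ l)))) ≡ c * g (i ℕ.+ l)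
  term i i≤m = begin
    a * (L * (s * b))       ≡⟨ solve 4 (λ a L s b → a :* (L :* (s :* b)) := L :* s :* (a :* b)) refl a L s b ⟩
    L * s * (a * b)         ≡⟨ cong (L * s *_) (weights i i≤m) ⟩
    L * s * (binom * f)     ≡⟨ solve 4 (λ L s b f → L :* s :* (b :* f) := L :* f :* (b :* s)) refl L s binom f ⟩
    c * g (i ℕ.+ l)         ∎
    where
    a = 1 /fact (suc (m ∸ i))
    b = 1 /fact (i ℕ.+ l)
    L = ℕ→ℚ (l !)
    s = ℕ→ℚ (S (i ℕ.+ l) l)
    binom = ℕ→ℚ (suc n C (i ℕ.+ l))
    f = 1 /fact (suc n)

bernUpTo-stable : ∀ {n i} → i ≤ n → bernUpTo n i ≡ B i
bernUpTo-stable {n} {i} i≤n with ℕₚ.m≤n⇒m<n∨m≡n i≤n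
... | inj₂ refl = refl
bernUpTo-stable {suc n} {i} _ | inj₁ (s≤s i≤n) with i ℕ.≤? n
... | yes _   = bernUpTo-stable i≤n
... | no  i≰n = ⊥-elim (i≰n i≤n)

B-suc : ∀ n → B (suc n) ≡ - ((ℤ.+ 1 ℚ./ suc (suc n)) * sumTo n (λ i → ℕ→ℚ (suc (suc n) C i) * B i))
B-suc n with suc n ℕ.≤? n
... | yes 1+n≤n = ⊥-elim (ℕₚ.1+n≰n 1+n≤n)
... | no  _     = cong (λ s → - ((ℤ.+ 1 ℚ./ suc (suc n)) * s))
  (sumTo-cong n (λ i i≤n → cong (ℕ→ℚ (suc (suc n) C i) *_) (bernUpTo-stable i≤n)))

[1+n]Cn≡1+n : ∀ n → suc n C n ≡ suc n
[1+n]Cn≡1+n n = begin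
  suc n C n              ≡⟨ nCk≡nC[n∸k] (ℕₚ.n≤1+n n) ⟩
  suc n C (suc n ∸ n)    ≡⟨ cong (suc n C_) (trans (ℕₚ.+-∸-assoc 1 (ℕₚ.≤-refl {n})) (cong suc (ℕₚ.n∸n≡0 n))) ⟩
  suc n C 1              ≡⟨ nC1≡n (suc n) ⟩
  suc n                  ∎
  where open ≡-Reasoning

sumTo-C*B : ∀ n → sumTo (suc n) (λ i → ℕ→ℚ (suc (suc n) C i) * B i) ≡ 0ℚ
sumTo-C*B n = begin
  Σ + ℕ→ℚ (suc (suc n) C suc n) * B (suc n)
    ≡⟨ cong₂ (λ c b → Σ + ℕ→ℚ c * b) ([1+n]Cn≡1+n (suc n)) (B-suc n) ⟩
  Σ + ℕ→ℚ (suc (suc n)) * (- (q * Σ))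
    ≡⟨ solve 3 (λ s N q → s :+ N :* (:- (q :* s)) := s :- (q :* N) :* s) refl Σ (ℕ→ℚ (suc (suc n))) q ⟩
  Σ - (q * ℕ→ℚ (suc (suc n))) * Σ
    ≡⟨ cong (λ c → Σ - c * Σ) (a/n*n≡a 1 (suc (suc n))) ⟩
  Σ - 1ℚ * Σ
    ≡⟨ solve 1 (λ s → s :- con 1ℚ :* s := con 0ℚ) refl Σ ⟩
  0ℚ ∎
  where
  open ≡-Reasoning
  open +-*-Solver
  q = ℤ.+ 1 ℚ./ suc (suc n)
  Σ = sumTo n (λ i → ℕ→ℚ (suc (suc n) C i) * B i)

z/[eᶻ-1] : Series
z/[eᶻ-1] j = B j * (1 /fact j)

[eᶻ-1]/z⋆z/[eᶻ-1] : ∀ j → ([eᶻ-1]/z ⋆ z/[eᶻ-1]) j ≡ δ j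
[eᶻ-1]/z⋆z/[eᶻ-1] zero    = refl
[eᶻ-1]/z⋆z/[eᶻ-1] (suc n) = begin
  ([eᶻ-1]/z ⋆ z/[eᶻ-1]) (suc n)
    ≡⟨ sumTo-cong (suc n) term ⟩
  sumTo (suc n) (λ i → f * (ℕ→ℚ (suc (suc n) C i) * B i))
    ≡⟨ sumTo-*ˡ (suc n) f _ ⟨
  f * sumTo (suc n) (λ i → ℕ→ℚ (suc (suc n) C i) * B i)
    ≡⟨ cong (f *_) (sumTo-C*B n) ⟩
  f * 0ℚ
    ≡⟨ ℚₚ.*-zeroʳ f ⟩
  0ℚ ∎
  where
  open ≡-Reasoning
  open +-*-Solver
  f = 1 /fact (suc (suc n))
  term : ∀ i → i ≤ suc n → [eᶻ-1]/z (suc n ∸ i) * z/[eᶻ-1] i ≡ f * (ℕ→ℚ (suc (suc n) C i) * B i)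
  term i i≤1+n = begin
    a * (B i * b)
      ≡⟨ solve 3 (λ a x b → a :* (x :* b) := x :* (b :* a)) refl a (B i) b ⟩
    B i * (b * a)
      ≡⟨ cong (λ k → B i * (b * (1 /fact k))) (ℕₚ.+-∸-assoc 1 i≤1+n) ⟨
    B i * (b * (1 /fact (suc (suc n) ∸ i)))
      ≡⟨ cong (B i *_) (nCk/n!≡1/k!*1/[n∸k]! (ℕₚ.m≤n⇒m≤1+n i≤1+n)) ⟨
    B i * (ℕ→ℚ (suc (suc n) C i) * f)
      ≡⟨ solve 3 (λ x c f → x :* (c :* f) := f :* (c :* x)) refl (B i) (ℕ→ℚ (suc (suc n) C i)) f ⟩
    f * (ℕ→ℚ (suc (suc n) C i) * B i) ∎
    where
    a = 1 /fact (suc (suc n ∸ i))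
    b = 1 /fact i

sign-+ : ∀ a b → sign (a ℕ.+ b) ≡ sign a * sign b
sign-+ zero    b = sym (ℚₚ.*-identityˡ (sign b))
sign-+ (suc a) b = trans (cong -_ (sign-+ a b)) (ℚₚ.neg-distribˡ-* (sign a) (sign b))

sign*sign≡1 : ∀ a → sign a * sign a ≡ 1ℚ
sign*sign≡1 zero    = refl
sign*sign≡1 (suc a) = trans (solve 1 (λ x → (:- x) :* (:- x) := x :* x) refl (sign a)) (sign*sign≡1 a)
  where open +-*-Solver

sign-even : ∀ k → sign (2 ℕ.* k) ≡ 1ℚ
sign-even k = trans (cong (λ m → sign (k ℕ.+ m)) (ℕₚ.+-identityʳ k)) (trans (sign-+ k k) (sign*sign≡1 k))

sumTo-sign*C : ∀ j → sumTo j (λ i → sign i * ℕ→ℚ (suc j C suc i)) ≡ 1ℚ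
sumTo-sign*C zero    = refl
sumTo-sign*C (suc j) = begin
  sumTo (suc j) (λ i → sign i * ℕ→ℚ (suc (suc j) C suc i))
    ≡⟨ sumTo-cong (suc j) (λ i _ → pascal i) ⟩
  sumTo (suc j) (λ i → sign i * ℕ→ℚ (suc j C i) + sign i * ℕ→ℚ (suc j C suc i))
    ≡⟨ sumTo-+ (suc j) _ _ ⟩
  sumTo (suc j) (λ i → sign i * ℕ→ℚ (suc j C i)) + (F + sign (suc j) * ℕ→ℚ (suc j C suc (suc j)))
    ≡⟨ cong₂ _+_ shiftedSum (cong (F +_) lastVanishes) ⟩
  (1ℚ + - F) + (F + 0ℚ)
    ≡⟨ solve 1 (λ f → (con 1ℚ :+ :- f) :+ (f :+ con 0ℚ) := con 1ℚ) refl F ⟩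
  1ℚ ∎
  where
  open ≡-Reasoning
  open +-*-Solver
  F = sumTo j (λ i → sign i * ℕ→ℚ (suc j C suc i))
  pascal : ∀ i → sign i * ℕ→ℚ (suc (suc j) C suc i) ≡ sign i * ℕ→ℚ (suc j C i) + sign i * ℕ→ℚ (suc j C suc i)
  pascal i = trans (cong (λ c → sign i * ℕ→ℚ c) (sym (nCk+nC[k+1]≡[n+1]C[k+1] (suc j) i)))
    (trans (cong (sign i *_) (ℕ→ℚ-+ (suc j C i) (suc j C suc i))) (ℚₚ.*-distribˡ-+ (sign i) _ _))
  shiftedSum : sumTo (suc j) (λ i → sign i * ℕ→ℚ (suc j C i)) ≡ 1ℚ + - F
  shiftedSum = trans (sumTo-suc j _)
    (cong (1ℚ +_) (trans (sumTo-cong j (λ i _ → sym (ℚₚ.neg-distribˡ-* (sign i) _))) (sumTo-neg j _)))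
  lastVanishes : sign (suc j) * ℕ→ℚ (suc j C suc (suc j)) ≡ 0ℚ
  lastVanishes = trans (cong (λ c → sign (suc j) * ℕ→ℚ c) (k>n⇒nCk≡0 (ℕₚ.n<1+n (suc j)))) (ℚₚ.*-zeroʳ (sign (suc j)))

reflect : Series → Series
reflect f j = sign j * f j

reflect-⋆ : ∀ f g j → (reflect f ⋆ reflect g) j ≡ reflect (f ⋆ g) j
reflect-⋆ f g j = trans (sumTo-cong j (λ i i≤j → term i i≤j)) (sym (sumTo-*ˡ j (sign j) _))
  where
  open +-*-Solver
  term : ∀ i → i ≤ j → sign (j ∸ i) * f (j ∸ i) * (sign i * g i) ≡ sign j * (f (j ∸ i) * g i)
  term i i≤j = trans
    (solve 4 (λ s a t x → (s :* a) :* (t :* x) := (s :* t) :* (a :* x)) refl (sign (j ∸ i)) (f (j ∸ i)) (sign i) (g i))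
    (cong (_* (f (j ∸ i) * g i)) (trans (sym (sign-+ (j ∸ i) i)) (cong sign (ℕₚ.m∸n+n≡m i≤j))))

reflect-δ : ∀ j → reflect δ j ≡ δ j
reflect-δ zero    = refl
reflect-δ (suc j) = ℚₚ.*-zeroʳ (sign (suc j))

eᶻ⋆reflect-[eᶻ-1]/z : ∀ j → (eᶻ ⋆ reflect [eᶻ-1]/z) j ≡ [eᶻ-1]/z j
eᶻ⋆reflect-[eᶻ-1]/z j = begin
  (eᶻ ⋆ reflect [eᶻ-1]/z) j
    ≡⟨ sumTo-cong j (λ i i≤j → term i i≤j) ⟩
  sumTo j (λ i → [eᶻ-1]/z j * (sign i * ℕ→ℚ (suc j C suc i)))
    ≡⟨ sumTo-*ˡ j ([eᶻ-1]/z j) _ ⟨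
  [eᶻ-1]/z j * sumTo j (λ i → sign i * ℕ→ℚ (suc j C suc i))
    ≡⟨ cong ([eᶻ-1]/z j *_) (sumTo-sign*C j) ⟩
  [eᶻ-1]/z j * 1ℚ
    ≡⟨ ℚₚ.*-identityʳ ([eᶻ-1]/z j) ⟩
  [eᶻ-1]/z j ∎
  where
  open ≡-Reasoning
  open +-*-Solver
  term : ∀ i → i ≤ j → eᶻ (j ∸ i) * (sign i * [eᶻ-1]/z i) ≡ [eᶻ-1]/z j * (sign i * ℕ→ℚ (suc j C suc i))
  term i i≤j = trans
    (solve 3 (λ e s w → e :* (s :* w) := s :* (w :* e)) refl (eᶻ (j ∸ i)) (sign i) ([eᶻ-1]/z i))
    (trans (cong (sign i *_) (sym (nCk/n!≡1/k!*1/[n∸k]! (s≤s i≤j))))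
      (solve 3 (λ s c w → s :* (c :* w) := w :* (s :* c)) refl (sign i) (ℕ→ℚ (suc j C suc i)) ([eᶻ-1]/z j)))

[eᶻ-1]/z⋆reflect-z/[eᶻ-1] : ∀ j → ([eᶻ-1]/z ⋆ reflect z/[eᶻ-1]) j ≡ eᶻ j
[eᶻ-1]/z⋆reflect-z/[eᶻ-1] j = begin
  ([eᶻ-1]/z ⋆ reflect z/[eᶻ-1]) j
    ≡⟨ ⋆-congˡ (reflect z/[eᶻ-1]) j (λ i → sym (eᶻ⋆reflect-[eᶻ-1]/z i)) ⟩
  ((eᶻ ⋆ reflect [eᶻ-1]/z) ⋆ reflect z/[eᶻ-1]) j
    ≡⟨ ⋆-assoc eᶻ (reflect [eᶻ-1]/z) (reflect z/[eᶻ-1]) j ⟩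
  (eᶻ ⋆ (reflect [eᶻ-1]/z ⋆ reflect z/[eᶻ-1])) j
    ≡⟨ ⋆-congʳ eᶻ j (λ i _ → trans (reflect-⋆ [eᶻ-1]/z z/[eᶻ-1] i)
                                  (trans (cong (sign i *_) ([eᶻ-1]/z⋆z/[eᶻ-1] i)) (reflect-δ i))) ⟩
  (eᶻ ⋆ δ) j
    ≡⟨ ⋆-identityʳ eᶻ j ⟩
  eᶻ j ∎
  where open ≡-Reasoning

z : Series
z zero    = 0ℚ
z (suc j) = δ j

[eᶻ-1]/z⋆z : ∀ j → ([eᶻ-1]/z ⋆ z) j ≡ eᶻ j - δ j
[eᶻ-1]/z⋆z zero    = refl
[eᶻ-1]/z⋆z (suc n) = begin
  ([eᶻ-1]/z ⋆ z) (suc n)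
    ≡⟨ sumTo-suc n _ ⟩
  [eᶻ-1]/z (suc n) * 0ℚ + sumTo n (λ i → [eᶻ-1]/z (n ∸ i) * δ i)
    ≡⟨ cong₂ _+_ (ℚₚ.*-zeroʳ ([eᶻ-1]/z (suc n))) (sumTo-*δ n (λ i → [eᶻ-1]/z (n ∸ i))) ⟩
  0ℚ + [eᶻ-1]/z n
    ≡⟨ solve 1 (λ x → con 0ℚ :+ x := x :- con 0ℚ) refl ([eᶻ-1]/z n) ⟩
  eᶻ (suc n) - δ (suc n) ∎
  where
  open ≡-Reasoning
  open +-*-Solver

reflect-z/[eᶻ-1] : ∀ j → reflect z/[eᶻ-1] j - z j ≡ z/[eᶻ-1] j
reflect-z/[eᶻ-1] j = ⋆-cancelˡ {[eᶻ-1]/z} refl j (λ i → reflect z/[eᶻ-1] i - z i) z/[eᶻ-1] sameProduct j ℕₚ.≤-refl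
  where
  open +-*-Solver
  sameProduct : ∀ i → i ≤ j → ([eᶻ-1]/z ⋆ (λ i → reflect z/[eᶻ-1] i - z i)) i ≡ ([eᶻ-1]/z ⋆ z/[eᶻ-1]) i
  sameProduct i _ = begin
    ([eᶻ-1]/z ⋆ (λ i → reflect z/[eᶻ-1] i - z i)) i
      ≡⟨ ⋆-subʳ [eᶻ-1]/z (reflect z/[eᶻ-1]) z i ⟩
    ([eᶻ-1]/z ⋆ reflect z/[eᶻ-1]) i - ([eᶻ-1]/z ⋆ z) i
      ≡⟨ cong₂ _-_ ([eᶻ-1]/z⋆reflect-z/[eᶻ-1] i) ([eᶻ-1]/z⋆z i) ⟩
    eᶻ i - (eᶻ i - δ i)
      ≡⟨ solve 2 (λ e d → e :- (e :- d) := d) refl (eᶻ i) (δ i) ⟩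
    δ i
      ≡⟨ [eᶻ-1]/z⋆z/[eᶻ-1] i ⟨
    ([eᶻ-1]/z ⋆ z/[eᶻ-1]) i ∎
    where open ≡-Reasoning

z/[eᶻ-1]-odd : ∀ n → z/[eᶻ-1] (suc (2 ℕ.* suc n)) ≡ 0ℚ
z/[eᶻ-1]-odd n = *-cancelʳ-ℕ→ℚ 2 (begin
  x * ℕ→ℚ 2                          ≡⟨ solve 1 (λ x → x :* con (ℕ→ℚ 2) := x :+ x) refl x ⟩
  x + x                              ≡⟨ cong (x +_) (reflect-z/[eᶻ-1] (suc (2 ℕ.* suc n))) ⟨
  x + (- sign (2 ℕ.* suc n) * x - 0ℚ) ≡⟨ cong (λ s → x + (- s * x - 0ℚ)) (sign-even (suc n)) ⟩
  x + (- 1ℚ * x - 0ℚ)                ≡⟨ solve 1 (λ x → x :+ (:- con 1ℚ :* x :- con 0ℚ) := con 0ℚ :* con (ℕ→ℚ 2)) refl x ⟩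
  0ℚ * ℕ→ℚ 2                         ∎)
  where
  open ≡-Reasoning
  open +-*-Solver
  x = z/[eᶻ-1] (suc (2 ℕ.* suc n))

stirlingSummand≡[δ-[eᶻ-1]/z]^ : ∀ m k →
  (k !) /fact (m ℕ.+ k) * sumTo k (λ l → sign l * ℕ→ℚ (((m ℕ.+ k) C (k ∸ l)) ℕ.* S (m ℕ.+ l) l))
    ≡ ([δ- [eᶻ-1]/z ]^ k) m
stirlingSummand≡[δ-[eᶻ-1]/z]^ m k = trans (sumTo-*ˡ k ((k !) /fact (m ℕ.+ k)) _) (sumTo-cong k (λ l l≤k →
  trans (solve 3 (λ a s x → a :* (s :* x) := s :* (a :* x)) refl ((k !) /fact (m ℕ.+ k)) (sign l) _)
        (cong (sign l *_) (trans (weight l l≤k) (sym (binomial l l≤k))))))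
  where
  open ≡-Reasoning
  open +-*-Solver
  common : ℕ → ℚ
  common l = ℕ→ℚ (k !) * ℕ→ℚ (S (m ℕ.+ l) l) * ((1 /fact (k ∸ l)) * (1 /fact (m ℕ.+ l)))
  weight : ∀ l → l ≤ k → (k !) /fact (m ℕ.+ k) * ℕ→ℚ (((m ℕ.+ k) C (k ∸ l)) ℕ.* S (m ℕ.+ l) l) ≡ common l
  weight l l≤k = begin
    (k !) /fact (m ℕ.+ k) * ℕ→ℚ (((m ℕ.+ k) C (k ∸ l)) ℕ.* S (m ℕ.+ l) l)
      ≡⟨ cong₂ _*_ (/fact≡*1/fact (k !) (m ℕ.+ k)) (ℕ→ℚ-* ((m ℕ.+ k) C (k ∸ l)) (S (m ℕ.+ l) l)) ⟩
    ℕ→ℚ (k !) * (1 /fact (m ℕ.+ k)) * (ℕ→ℚ ((m ℕ.+ k) C (k ∸ l)) * ℕ→ℚ (S (m ℕ.+ l) l))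
      ≡⟨ solve 4 (λ K f c s → K :* f :* (c :* s) := K :* s :* (c :* f)) refl
           (ℕ→ℚ (k !)) (1 /fact (m ℕ.+ k)) (ℕ→ℚ ((m ℕ.+ k) C (k ∸ l))) (ℕ→ℚ (S (m ℕ.+ l) l)) ⟩
    ℕ→ℚ (k !) * ℕ→ℚ (S (m ℕ.+ l) l) * (ℕ→ℚ ((m ℕ.+ k) C (k ∸ l)) * (1 /fact (m ℕ.+ k)))
      ≡⟨ cong (ℕ→ℚ (k !) * ℕ→ℚ (S (m ℕ.+ l) l) *_)
           (nCk/n!≡1/k!*1/[n∸k]! (ℕₚ.≤-trans (ℕₚ.m∸n≤m k l) (ℕₚ.m≤n+m k m))) ⟩
    ℕ→ℚ (k !) * ℕ→ℚ (S (m ℕ.+ l) l) * ((1 /fact (k ∸ l)) * (1 /fact (m ℕ.+ k ∸ (k ∸ l))))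
      ≡⟨ cong (λ i → ℕ→ℚ (k !) * ℕ→ℚ (S (m ℕ.+ l) l) * ((1 /fact (k ∸ l)) * (1 /fact i))) complement ⟩
    common l ∎
    where
    complement : m ℕ.+ k ∸ (k ∸ l) ≡ m ℕ.+ l
    complement = trans (ℕₚ.+-∸-assoc m (ℕₚ.m∸n≤m k l)) (cong (m ℕ.+_) (ℕₚ.m∸[m∸n]≡n l≤k))
  binomial : ∀ l → l ≤ k → ℕ→ℚ (k C l) * ([eᶻ-1]/z ^ l) m ≡ common l
  binomial l l≤k = begin
    ℕ→ℚ (k C l) * ([eᶻ-1]/z ^ l) m
      ≡⟨ cong₂ _*_ (nCk≡n!/[k![n∸k]!] l≤k) ([eᶻ-1]/z^ l m) ⟩
    K * (f * g) * (L * (s * h))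
      ≡⟨ solve 6 (λ K f g L s h → K :* (f :* g) :* (L :* (s :* h)) := K :* s :* (g :* h) :* (f :* L)) refl K f g L s h ⟩
    common l * ((1 /fact l) * ℕ→ℚ (l !))
      ≡⟨ cong (common l *_) (a/n!*n!≡a 1 l) ⟩
    common l * 1ℚ
      ≡⟨ ℚₚ.*-identityʳ (common l) ⟩
    common l ∎
    where
    K = ℕ→ℚ (k !)
    f = 1 /fact l
    g = 1 /fact (k ∸ l)
    L = ℕ→ℚ (l !)
    s = ℕ→ℚ (S (m ℕ.+ l) l)
    h = 1 /fact (m ℕ.+ l)

stirlingSum : ℕ → ℚ
stirlingSum m = sumTo m (λ k → (k !) /fact (m ℕ.+ k) * sumTo k (λ l → sign l * ℕ→ℚ (((m ℕ.+ k) C (k ∸ l)) ℕ.* S (m ℕ.+ l) l)))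

stirlingSum≡z/[eᶻ-1] : ∀ m → stirlingSum m ≡ z/[eᶻ-1] m
stirlingSum≡z/[eᶻ-1] m = trans (sumTo-cong m (λ k _ → stirlingSummand≡[δ-[eᶻ-1]/z]^ m k))
  (neumann≡inverse z/[eᶻ-1] refl [eᶻ-1]/z⋆z/[eᶻ-1] m m ℕₚ.≤-refl)

mainTheorem14 : (n : ℕ) → 1 ≤ n →
    (B (2 ℕ.* n) ≡ ℕ→ℚ ((2 ℕ.* n) !) *
        sumTo (2 ℕ.* n) (λ k → (k !) /fact (2 ℕ.* n ℕ.+ k) *
          sumTo k (λ l → sign l * ℕ→ℚ (((2 ℕ.* n ℕ.+ k) C (k ∸ l)) ℕ.* S (2 ℕ.* n ℕ.+ l) l))))
    × (sumTo (2 ℕ.* n ℕ.+ 1) (λ k → (k !) /fact (2 ℕ.* n ℕ.+ k ℕ.+ 1) *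
          sumTo k (λ l → sign l * ℕ→ℚ (((2 ℕ.* n ℕ.+ k ℕ.+ 1) C (k ∸ l)) ℕ.* S (2 ℕ.* n ℕ.+ l ℕ.+ 1) l)))
       ≡ 0ℚ)
mainTheorem14 (suc n) _ = evenCase , oddCase
  where
  open ≡-Reasoning
  m = 2 ℕ.* suc n
  evenCase : B m ≡ ℕ→ℚ (m !) * stirlingSum m
  evenCase = sym (begin
    ℕ→ℚ (m !) * stirlingSum m           ≡⟨ cong (ℕ→ℚ (m !) *_) (stirlingSum≡z/[eᶻ-1] m) ⟩
    ℕ→ℚ (m !) * (B m * (1 /fact m))     ≡⟨ ℚₚ.*-comm (ℕ→ℚ (m !)) _ ⟩
    B m * (1 /fact m) * ℕ→ℚ (m !)       ≡⟨ ℚₚ.*-assoc (B m) (1 /fact m) (ℕ→ℚ (m !)) ⟩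
    B m * ((1 /fact m) * ℕ→ℚ (m !))     ≡⟨ cong (B m *_) (a/n!*n!≡a 1 m) ⟩
    B m * 1ℚ                            ≡⟨ ℚₚ.*-identityʳ (B m) ⟩
    B m                                 ∎)
  shift : ∀ a → m ℕ.+ a ℕ.+ 1 ≡ m ℕ.+ 1 ℕ.+ a
  shift a = trans (ℕₚ.+-assoc m a 1) (trans (cong (m ℕ.+_) (ℕₚ.+-comm a 1)) (sym (ℕₚ.+-assoc m 1 a)))
  oddCase = begin
    sumTo (m ℕ.+ 1) (λ k → (k !) /fact (m ℕ.+ k ℕ.+ 1) *
      sumTo k (λ l → sign l * ℕ→ℚ (((m ℕ.+ k ℕ.+ 1) C (k ∸ l)) ℕ.* S (m ℕ.+ l ℕ.+ 1) l)))
      ≡⟨ sumTo-cong (m ℕ.+ 1) (λ k _ → cong₂ (λ a t → (k !) /fact a * t) (shift k)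
           (sumTo-cong k (λ l _ → cong₂ (λ a b → sign l * ℕ→ℚ ((a C (k ∸ l)) ℕ.* S b l)) (shift k) (shift l)))) ⟩
    stirlingSum (m ℕ.+ 1)   ≡⟨ stirlingSum≡z/[eᶻ-1] (m ℕ.+ 1) ⟩
    z/[eᶻ-1] (m ℕ.+ 1)      ≡⟨ cong z/[eᶻ-1] (ℕₚ.+-comm m 1) ⟩
    z/[eᶻ-1] (suc m)        ≡⟨ z/[eᶻ-1]-odd n ⟩
    0ℚ                      ∎
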